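{- Let $G$ be a subdivision of $K_5$ with branch vertices $a,b,c,d,e$ such that the five edges $ab,bc,cd,de,ea$ of $K_5$ are not subdivided (they are edges of $G$) and each of the other five edges of $K_5$ is subdivided at least once (type B). Then $G$ is not a derived graph.
   Context: A subdivision of a graph is obtained by replacing some edges by paths of length at least $1$; an edge is subdivided if replaced by a path of length at least $2$. A Burling tree is a 4-tuple $(T,r,\mathrm{last},\mathrm{choose})$ where $T$ is a tree rooted at $r$; $\mathrm{last}$ assigns to every non-leaf vertex $v$ one of its children (its last-born); and $\mathrm{choose}$ assigns to every vertex $v$ that is neither the root nor a last-born the vertex set of a (possibly empty) downward branch of $T$ starting at the last-born of the parent of $v$, with $\mathrm{choose}(v)=\emptyset$ for the root and last-borns. The oriented graph fully derived from $T$ has vertex set $V(T)$ and arc $uv$ iff $v\in\mathrm{choose}(u)$. An oriented graph is derived if it is an induced subgraph of a graph fully derived from some Burling tree; a non-oriented graph is derived if it is the underlying graph of an oriented derived graph. -}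

module Defs where

open import Data.Nat using (ℕ; zero; suc; _≥_)
open import Data.Fin using (Fin; toℕ; _<_)
open import Data.Maybe using (Maybe; just; nothing)
open import Data.Product using (Σ; ∃; ∃-syntax; _×_; _,_)
open import Data.Sum using (_⊎_)
open import Relation.Nullary using (¬_)
open import Relation.Binary.PropositionalEquality using (_≡_; _≢_)
open import Function.Definitions using (Injective)

iter : {A : Set} → (A → A) → ℕ → A → A
iter f zero    x = x
iter f (suc k) x = f (iter f k x)

AncEq : {n : ℕ} → (Fin n → Fin n) → Fin n → Fin n → Set
AncEq parent a x = ∃[ k ] (iter parent k x ≡ a)

IsChild : {n : ℕ} → Fin n → (Fin n → Fin n) → Fin n → Fin n → Set
IsChild root parent c v = (c ≢ root) × (parent c ≡ v)

HasChild : {n : ℕ} → Fin n → (Fin n → Fin n) → Fin n → Set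
HasChild root parent v = ∃[ c ] IsChild root parent c v

IsLastBorn : {n : ℕ} → Fin n → (Fin n → Fin n) → (Fin n → Fin n) → Fin n → Set
IsLastBorn root parent last c = (c ≢ root) × (last (parent c) ≡ c)

-- A Burling tree on vertex set Fin n.
-- choose v ≡ nothing encodes choose(v) = ∅;
-- choose v ≡ just b encodes choose(v) = vertex set of the downward path
-- from last(parent v) down to its descendant b.
record BurlingTree (n : ℕ) : Set where
  field
    root         : Fin n
    parent       : Fin n → Fin n
    parent-root  : parent root ≡ root
    reaches-root : ∀ v → AncEq parent root v
    last         : Fin n → Fin n
    last-child   : ∀ v → HasChild root parent v → IsChild root parent (last v) v
    choose       : Fin n → Maybe (Fin n)
    choose-empty : ∀ v → (v ≡ root) ⊎ IsLastBorn root parent last v → choose v ≡ nothing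
    choose-branch : ∀ v b → choose v ≡ just b → AncEq parent (last (parent v)) b

Arc : {n : ℕ} → BurlingTree n → Fin n → Fin n → Set
Arc T u x =
  ∃[ b ] ((choose u ≡ just b) × AncEq parent (last (parent u)) x × AncEq parent x b)
  where open BurlingTree T

-- A (non-oriented) graph on Fin m with adjacency Adj is derived:
-- it is the underlying graph of an induced subgraph of a graph fully
-- derived from some Burling tree (induced subgraph up to isomorphism,
-- i.e. via an injective vertex map).
Derived : (m : ℕ) → (Fin m → Fin m → Set) → Set
Derived m Adj =
  ∃[ n ] Σ (BurlingTree n) λ T → Σ (Fin m → Fin n) λ f →
    Injective _≡_ _≡_ f ×
    (∀ x y → (Adj x y → Arc T (f x) (f y) ⊎ Arc T (f y) (f x))
           × (Arc T (f x) (f y) ⊎ Arc T (f y) (f x) → Adj x y))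

-- Branch vertices are br i (i : Fin 5); the edge ij (i < j) of K5 is
-- replaced by the path br i — int i j p 0 — … — int i j p (s-1) — br j,
-- where s = sub i j p is the number of subdivision vertices.

Subdiv : Set
Subdiv = (i j : Fin 5) → i < j → ℕ

data SubV (sub : Subdiv) : Set where
  br  : Fin 5 → SubV sub
  int : (i j : Fin 5) (p : i < j) → Fin (sub i j p) → SubV sub

data Step (sub : Subdiv) : SubV sub → SubV sub → Set where
  direct : ∀ i j p → sub i j p ≡ 0 → Step sub (br i) (br j)
  first  : ∀ i j p (t : Fin (sub i j p)) → toℕ t ≡ 0 → Step sub (br i) (int i j p t)
  middle : ∀ i j p (t t' : Fin (sub i j p)) → toℕ t' ≡ suc (toℕ t) →
           Step sub (int i j p t) (int i j p t')
  final  : ∀ i j p (t : Fin (sub i j p)) → suc (toℕ t) ≡ sub i j p →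
           Step sub (int i j p t) (br j)

SubAdj : (sub : Subdiv) → SubV sub → SubV sub → Set
SubAdj sub u v = Step sub u v ⊎ Step sub v u

-- branch vertices a,b,c,d,e are br 0, …, br 4; the cycle edges
-- ab, bc, cd, de, ea are the pairs (i, i+1) and (0, 4).
CycleEdge : Fin 5 → Fin 5 → Set
CycleEdge i j = (toℕ j ≡ suc (toℕ i)) ⊎ ((toℕ i ≡ 0) × (toℕ j ≡ 4))

TypeB : Subdiv → Set
TypeB sub = ∀ i j (p : i < j) →
  (CycleEdge i j → sub i j p ≡ 0) × (¬ CycleEdge i j → sub i j p ≥ 1)

IsK5SubdivTypeB : (m : ℕ) → (Fin m → Fin m → Set) → Set
IsK5SubdivTypeB m Adj =
  Σ Subdiv λ sub → TypeB sub ×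
  Σ (Fin m → SubV sub) λ φ → Σ (SubV sub → Fin m) λ ψ →
    (∀ x → ψ (φ x) ≡ x) × (∀ v → φ (ψ v) ≡ v) ×
    (∀ x y → (Adj x y → SubAdj sub (φ x) (φ y)) × (SubAdj sub (φ x) (φ y) → Adj x y))

{-# OPTIONS --safe #-}
module Submission where

-- Every arc u → x of a fully derived graph ends below the last-born sibling of u, so the parent
-- can only move down along arcs and the pentagon a b c d e of unsubdivided edges is not a directed
-- cycle: some branch vertex b points to both neighbours a and c, which then lie on one branch,
-- say a above c. Two facts about the tree drive the rest: a walk that starts strictly below w and
-- avoids the neighbourhood of w stays strictly below w, and an edge leaving the subtree of w is an
-- arc pointing into it from a vertex that also points to w. The inner vertices of the subdivided
-- edges d ⋯ b and c ⋯ e are adjacent to no other vertex of the pentagon, and chasing both paths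
-- this way forces the arcs d → c and c → d at once, which is impossible.

open import Defs
open import Data.Nat
  using (ℕ; zero; suc; pred; _+_; _*_; _∸_; _≤_; _<_; z≤n; s≤s; _≤?_; _<?_; >-nonZero) renaming (_≟_ to _≟ℕ_)
open import Data.Nat.Properties
  using (≤-refl; <⇒≤; ≰⇒>; <-irrefl; n∸n≡0; m∸n≤m; +-∸-assoc; +-comm; m≤m*n; m≤n⇒∃[o]m+o≡n; suc-pred)
open import Data.Fin using (Fin; toℕ; fromℕ; fromℕ<; #_) renaming (_<_ to _<ᶠ_)
open import Data.Fin.Properties using (_≟_; toℕ-fromℕ; toℕ-fromℕ<; any?; <-cmp)
open import Data.Maybe using (just; nothing)
open import Data.Product using (Σ; ∃-syntax; _×_; _,_; proj₁; proj₂)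
open import Data.Sum using (_⊎_; inj₁; inj₂; [_,_]′)
open import Data.Empty using (⊥; ⊥-elim)
open import Function using (_∘_; id)
open import Function.Definitions using (Injective)
open import Relation.Nullary using (¬_; Dec; yes; no; contradiction)
open import Relation.Nullary.Decidable using (True; toWitness; _×-dec_; _⊎-dec_; ¬?)
open import Relation.Binary.Definitions using (Symmetric; Decidable; tri<; tri≈; tri>)
open import Relation.Binary.PropositionalEquality
  using (_≡_; _≢_; refl; sym; trans; cong; subst; subst₂; ≢-sym; module ≡-Reasoning)

iter-suc : {A : Set} (f : A → A) (k : ℕ) (x : A) → iter f (suc k) x ≡ iter f k (f x)
iter-suc f zero    x = refl
iter-suc f (suc k) x = cong f (iter-suc f k x)

iter-+ : {A : Set} (f : A → A) (k l : ℕ) (x : A) → iter f (k + l) x ≡ iter f k (iter f l x)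
iter-+ f zero    l x = refl
iter-+ f (suc k) l x = cong f (iter-+ f k l x)

iter-fixed : {A : Set} (f : A → A) {r : A} → f r ≡ r → (k : ℕ) → iter f k r ≡ r
iter-fixed f fr≡r zero    = refl
iter-fixed f fr≡r (suc k) = trans (cong f (iter-fixed f fr≡r k)) fr≡r

iter-periodic : {A : Set} (f : A → A) {x : A} (k : ℕ) → iter f k x ≡ x → (q : ℕ) → iter f (q * k) x ≡ x
iter-periodic f k period zero    = refl
iter-periodic f {x} k period (suc q) =
  trans (iter-+ f k (q * k) x) (trans (cong (iter f k) (iter-periodic f k period q)) period)

∸-suc : ∀ {m k} → k < m → m ∸ k ≡ suc (m ∸ suc k)
∸-suc {suc m} (s≤s k≤m) = +-∸-assoc 1 k≤m

record Walk {V : Set} (_~_ : V → V → Set) (x y : V) : Set where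
  field
    length : ℕ
    vertex : ℕ → V
    start  : vertex 0 ≡ x
    end    : vertex length ≡ y
    step   : ∀ {k} → k < length → vertex k ~ vertex (suc k)

AllVertices : {V : Set} {_~_ : V → V → Set} {x y : V} → (V → Set) → Walk _~_ x y → Set
AllVertices P W = ∀ {k} → k ≤ Walk.length W → P (Walk.vertex W k)

reverse : {V : Set} {_~_ : V → V → Set} {x y : V} → Symmetric _~_ → Walk _~_ x y → Walk _~_ y x
reverse {_~_ = _~_} ~-sym W = record
  { length = length
  ; vertex = λ k → vertex (length ∸ k)
  ; start  = end
  ; end    = trans (cong vertex (n∸n≡0 length)) start
  ; step   = reversed-step
  }
  where
  open Walk W
  reversed-step : ∀ {k} → k < length → vertex (length ∸ k) ~ vertex (length ∸ suc k)
  reversed-step {k} k<L rewrite ∸-suc k<L =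
    ~-sym (step (subst (_≤ length) (∸-suc k<L) (m∸n≤m length k)))

all-reverse : {V : Set} {_~_ : V → V → Set} {x y : V} {P : V → Set} (~-sym : Symmetric _~_)
  (W : Walk _~_ x y) → AllVertices P W → AllVertices P (reverse ~-sym W)
all-reverse ~-sym W all {k} _ = all (m∸n≤m (Walk.length W) k)

record PathVia {V : Set} (_~_ : V → V → Set) (P : V → Set) (x y : V) : Set where
  field
    {entry exit} : V
    enter : x ~ entry
    walk  : Walk _~_ entry exit
    leave : exit ~ y
    inner : AllVertices P walk

  exit-inner : P exit
  exit-inner = subst P (Walk.end walk) (inner ≤-refl)

reversePath : {V : Set} {_~_ : V → V → Set} {P : V → Set} {x y : V} →
  Symmetric _~_ → PathVia _~_ P x y → PathVia _~_ P y x
reversePath {P = P} ~-sym Q = record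
  { enter = ~-sym leave
  ; walk  = reverse ~-sym walk
  ; leave = ~-sym enter
  ; inner = all-reverse {P = P} ~-sym walk inner
  }
  where open PathVia Q

module _ {V U : Set} {_~_ : V → V → Set} {_≈_ : U → U → Set}
         (g : V → U) (g-hom : ∀ {u v} → u ~ v → g u ≈ g v) where

  mapWalk : {x y : V} → Walk _~_ x y → Walk _≈_ (g x) (g y)
  mapWalk W = record
    { length = length ; vertex = g ∘ vertex ; start = cong g start ; end = cong g end
    ; step = g-hom ∘ step }
    where open Walk W

  mapPath : {P : V → Set} {Q : U → Set} {x y : V} →
    (∀ {u} → P u → Q (g u)) → PathVia _~_ P x y → PathVia _≈_ Q (g x) (g y)
  mapPath P⇒Q R = record
    { enter = g-hom enter ; walk = mapWalk walk ; leave = g-hom leave ; inner = P⇒Q ∘ inner }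
    where open PathVia R

module BurlingTreeProperties {n : ℕ} (T : BurlingTree n) where
  open BurlingTree T
  open ≡-Reasoning

  infix 4 _≼_ _~_

  _≼_ : Fin n → Fin n → Set
  _≼_ = AncEq parent

  _~_ : Fin n → Fin n → Set
  u ~ x = Arc T u x ⊎ Arc T x u

  ~-sym : Symmetric _~_
  ~-sym (inj₁ arc) = inj₂ arc
  ~-sym (inj₂ arc) = inj₁ arc

  ≼-refl : ∀ {a} → a ≼ a
  ≼-refl = 0 , refl

  ≼-trans : ∀ {a b c} → a ≼ b → b ≼ c → a ≼ c
  ≼-trans {c = c} (k , bₖ≡a) (l , cₗ≡b) = k + l , trans (iter-+ parent k l c) (trans (cong (iter parent k) cₗ≡b) bₖ≡a)

  parent-≼ : ∀ {x} → parent x ≼ x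
  parent-≼ = 1 , refl

  ≼-parent : ∀ {a x} → a ≼ x → parent a ≼ parent x
  ≼-parent {x = x} (k , xₖ≡a) = k , trans (sym (iter-suc parent k x)) (cong parent xₖ≡a)

  ≼-unfold : ∀ {a x} → a ≼ x → x ≡ a ⊎ a ≼ parent x
  ≼-unfold (zero  , x≡a)  = inj₁ x≡a
  ≼-unfold {x = x} (suc k , xₖ≡a) = inj₂ (k , trans (sym (iter-suc parent k x)) xₖ≡a)

  ≼∧≢⇒≼parent : ∀ {a x} → a ≼ x → x ≢ a → a ≼ parent x
  ≼∧≢⇒≼parent a≼x x≢a with ≼-unfold a≼x
  ... | inj₁ x≡a  = contradiction x≡a x≢a
  ... | inj₂ a≼px = a≼px

  ≼-total : ∀ {a b x} → a ≼ x → b ≼ x → a ≼ b ⊎ b ≼ a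
  ≼-total {a} {b} {x} (k , xₖ≡a) (l , xₗ≡b) = compare k l x xₖ≡a xₗ≡b
    where
    compare : ∀ k l y → iter parent k y ≡ a → iter parent l y ≡ b → a ≼ b ⊎ b ≼ a
    compare zero l y y≡a yₗ≡b = inj₂ (l , trans (cong (iter parent l) (sym y≡a)) yₗ≡b)
    compare (suc k) zero y yₖ≡a y≡b = inj₁ (suc k , trans (cong (iter parent (suc k)) (sym y≡b)) yₖ≡a)
    compare (suc k) (suc l) y yₖ≡a yₗ≡b =
      compare k l (parent y) (trans (sym (iter-suc parent k y)) yₖ≡a) (trans (sym (iter-suc parent l y)) yₗ≡b)

  iter-beyond-root : ∀ {j k x} → iter parent j x ≡ root → j ≤ k → iter parent k x ≡ root
  iter-beyond-root {j} {k} {x} xⱼ≡root j≤k with m≤n⇒∃[o]m+o≡n j≤k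
  ... | d , refl = begin
    iter parent (j + d) x   ≡⟨ cong (λ l → iter parent l x) (+-comm j d) ⟩
    iter parent (d + j) x   ≡⟨ iter-+ parent d j x ⟩
    iter parent d (iter parent j x) ≡⟨ cong (iter parent d) xⱼ≡root ⟩
    iter parent d root      ≡⟨ iter-fixed parent parent-root d ⟩
    root                    ∎

  -- Going around the cycle j times, where j is the distance from v to the root, ends at the root.
  periodic⇒root : ∀ {v} k → iter parent (suc k) v ≡ v → v ≡ root
  periodic⇒root {v} k period with reaches-root v
  ... | j , vⱼ≡root = begin
    v                        ≡⟨ sym (iter-periodic parent (suc k) period j) ⟩
    iter parent (j * suc k) v ≡⟨ iter-beyond-root vⱼ≡root (m≤m*n j (suc k)) ⟩
    root                     ∎

  ≼-antisym : ∀ {a b} → a ≼ b → b ≼ a → a ≡ b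
  ≼-antisym (zero , b≡a) _ = sym b≡a
  ≼-antisym {a} {b} (suc k , bₖ≡a) (l , aₗ≡b) = trans a≡root (sym b≡root)
    where
    a≡root : a ≡ root
    a≡root = periodic⇒root (k + l)
      (trans (iter-+ parent (suc k) l a) (trans (cong (iter parent (suc k)) aₗ≡b) bₖ≡a))
    b≡root : b ≡ root
    b≡root = trans (sym aₗ≡b) (trans (cong (iter parent l) a≡root) (iter-fixed parent parent-root l))

  -- Every ancestor of x is reached within the distance from x to the root.
  _≼?_ : Decidable _≼_
  a ≼? x with reaches-root x
  ... | j , xⱼ≡root with any? {P = λ k → iter parent (toℕ k) x ≡ a} (λ k → iter parent (toℕ k) x ≟ a)
  ...   | yes (k , xₖ≡a) = yes (toℕ k , xₖ≡a)
  ...   | no ¬bounded = no λ { (k , xₖ≡a) → ¬bounded (bounded k xₖ≡a) }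
    where
    bounded : ∀ k → iter parent k x ≡ a → Σ (Fin (suc j)) λ k′ → iter parent (toℕ k′) x ≡ a
    bounded k xₖ≡a with k ≤? j
    ... | yes k≤j = fromℕ< (s≤s k≤j) , trans (cong (λ l → iter parent l x) (toℕ-fromℕ< (s≤s k≤j))) xₖ≡a
    ... | no  k≰j = fromℕ j , trans (cong (λ l → iter parent l x) (toℕ-fromℕ j))
                      (trans xⱼ≡root (trans (sym (iter-beyond-root xⱼ≡root (<⇒≤ (≰⇒> k≰j)))) xₖ≡a))

  siblings-≼⇒≡ : ∀ {c c′} → c ≢ root → parent c ≡ parent c′ → c ≼ c′ → c ≡ c′
  siblings-≼⇒≡ c≢root pc≡pc′ (zero , c′≡c) = sym c′≡c
  siblings-≼⇒≡ {c} {c′} c≢root pc≡pc′ (suc k , c′ₖ₊₁≡c) = contradiction (periodic⇒root k cycle) c≢root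
    where
    cycle : iter parent (suc k) c ≡ c
    cycle = trans (iter-suc parent k c) (trans (cong (iter parent k) pc≡pc′)
              (trans (sym (iter-suc parent k c′)) c′ₖ₊₁≡c))

  lastSib : Fin n → Fin n
  lastSib u = last (parent u)

  Chooses : Fin n → Set
  Chooses u = ∃[ b ] (choose u ≡ just b)

  module _ {u} (chooses : Chooses u) where

    private
      choose≢nothing : choose u ≢ nothing
      choose≢nothing empty with trans (sym (proj₂ chooses)) empty
      ... | ()

    chooses⇒≢root : u ≢ root
    chooses⇒≢root u≡root = choose≢nothing (choose-empty u (inj₁ u≡root))

    chooses⇒≢lastSib : lastSib u ≢ u
    chooses⇒≢lastSib lastborn = choose≢nothing (choose-empty u (inj₂ (chooses⇒≢root , lastborn)))

    lastSib-child : IsChild root parent (lastSib u) (parent u)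
    lastSib-child = last-child (parent u) (u , chooses⇒≢root , refl)

    lastSib⋠ : ¬ lastSib u ≼ u
    lastSib⋠ h = chooses⇒≢lastSib (siblings-≼⇒≡ (proj₁ lastSib-child) (proj₂ lastSib-child) h)

    ⋠lastSib : ¬ u ≼ lastSib u
    ⋠lastSib h = chooses⇒≢lastSib (sym (siblings-≼⇒≡ chooses⇒≢root (sym (proj₂ lastSib-child)) h))

  arc⇒chooses : ∀ {u x} → Arc T u x → Chooses u
  arc⇒chooses (b , chosen , _) = b , chosen

  arc⇒lastSib≼ : ∀ {u x} → Arc T u x → lastSib u ≼ x
  arc⇒lastSib≼ (_ , _ , lastSib≼x , _) = lastSib≼x

  parent≼lastSib : ∀ {u x} → Arc T u x → parent u ≼ lastSib u
  parent≼lastSib {u} arc = subst (_≼ lastSib u) (proj₂ (lastSib-child (arc⇒chooses arc))) parent-≼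

  arc⇒⋠ : ∀ {u x} → Arc T u x → ¬ u ≼ x
  arc⇒⋠ arc u≼x with ≼-total u≼x (arc⇒lastSib≼ arc)
  ... | inj₁ u≼s = ⋠lastSib (arc⇒chooses arc) u≼s
  ... | inj₂ s≼u = lastSib⋠ (arc⇒chooses arc) s≼u

  arc⇒⋡ : ∀ {u x} → Arc T u x → ¬ x ≼ u
  arc⇒⋡ arc x≼u = lastSib⋠ (arc⇒chooses arc) (≼-trans (arc⇒lastSib≼ arc) x≼u)

  ~⇒⋠ : ∀ {u x} → u ~ x → ¬ u ≼ x
  ~⇒⋠ (inj₁ arc) = arc⇒⋠ arc
  ~⇒⋠ (inj₂ arc) = arc⇒⋡ arc

  out-neighbours-comparable : ∀ {u x y} → Arc T u x → Arc T u y → x ≼ y ⊎ y ≼ x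
  out-neighbours-comparable (b , chosen , _ , x≼b) (b′ , chosen′ , _ , y≼b′)
    with trans (sym chosen) chosen′
  ... | refl = ≼-total x≼b y≼b′

  arc⇒parent≼ : ∀ {u x} → Arc T u x → parent u ≼ parent x
  arc⇒parent≼ {x = x} arc = subst (_≼ parent x) (proj₂ (lastSib-child (arc⇒chooses arc))) (≼-parent (arc⇒lastSib≼ arc))

  -- An arc between siblings ends at the last-born, which has no out-arcs.
  arc-arc⇒parents-differ : ∀ {u x y} → Arc T u x → Arc T x y → parent u ≢ parent x
  arc-arc⇒parents-differ {u} {x} ux xy pu≡px = chooses⇒≢lastSib (arc⇒chooses xy) x≡lastSib-x
    where
    s≡x : lastSib u ≡ x
    s≡x = siblings-≼⇒≡ (proj₁ (lastSib-child (arc⇒chooses ux)))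
            (trans (proj₂ (lastSib-child (arc⇒chooses ux))) pu≡px) (arc⇒lastSib≼ ux)
    x≡lastSib-x : lastSib x ≡ x
    x≡lastSib-x = trans (cong last (sym pu≡px)) s≡x

  no-2-cycle : ∀ {u x} → Arc T u x → Arc T x u → ⊥
  no-2-cycle ux xu = arc-arc⇒parents-differ ux xu (≼-antisym (arc⇒parent≼ ux) (arc⇒parent≼ xu))

  no-5-cycle : ∀ {u₁ u₂ u₃ u₄ u₅} →
    Arc T u₁ u₂ → Arc T u₂ u₃ → Arc T u₃ u₄ → Arc T u₄ u₅ → Arc T u₅ u₁ → ⊥
  no-5-cycle a₁₂ a₂₃ a₃₄ a₄₅ a₅₁ = arc-arc⇒parents-differ a₁₂ a₂₃ (≼-antisym (arc⇒parent≼ a₁₂)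
    (≼-trans (arc⇒parent≼ a₂₃) (≼-trans (arc⇒parent≼ a₃₄) (≼-trans (arc⇒parent≼ a₄₅) (arc⇒parent≼ a₅₁)))))

  -- An arc u → z would keep z inside the subtree of parent u, hence of a; so the edge is an arc
  -- z → u, and since the branch choose(z) starts at a sibling of z, outside the subtree, it runs through a.
  edge-leaving-subtree : ∀ {a u z} → a ≼ parent u → ¬ a ≼ z → u ~ z → Arc T z u × Arc T z a
  edge-leaving-subtree a≼pu a⋠z (inj₁ uz) =
    ⊥-elim (a⋠z (≼-trans a≼pu (≼-trans (parent≼lastSib uz) (arc⇒lastSib≼ uz))))
  edge-leaving-subtree {a} {u} {z} a≼pu a⋠z (inj₂ zu@(b , chosen , s≼u , u≼b)) =
    zu , (b , chosen , lastSib≼a , ≼-trans (≼-trans a≼pu parent-≼) u≼b)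
    where
    lastSib≼a : lastSib z ≼ a
    lastSib≼a with ≼-total s≼u (≼-trans a≼pu parent-≼)
    ... | inj₁ s≼a = s≼a
    ... | inj₂ a≼s with ≼-unfold a≼s
    ...   | inj₁ s≡a  = subst (lastSib z ≼_) s≡a ≼-refl
    ...   | inj₂ a≼ps = ⊥-elim (a⋠z (≼-trans a≼ps (subst (_≼ z) (sym (proj₂ (lastSib-child (arc⇒chooses zu)))) parent-≼)))

  ≼parent-step : ∀ {w u v} → w ≼ parent u → u ~ v → ¬ v ~ w → w ≼ parent v
  ≼parent-step {w} {u} {v} w≼pu u~v v≁w with w ≼? v
  ... | no w⋠v = ⊥-elim (v≁w (inj₁ (proj₂ (edge-leaving-subtree w≼pu w⋠v u~v))))
  ... | yes w≼v with ≼-unfold w≼v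
  ...   | inj₁ v≡w  = ⊥-elim (~⇒⋠ (~-sym u~v) (subst (_≼ u) (sym v≡w) (≼-trans w≼pu parent-≼)))
  ...   | inj₂ w≼pv = w≼pv

  ≼parent-along : ∀ {w x y} {P : Fin n → Set} → (∀ {t} → P t → ¬ t ~ w) →
    w ≼ parent x → (W : Walk _~_ x y) → AllVertices P W → w ≼ parent y
  ≼parent-along {w} P⇒≁w w≼px W all = subst (λ t → w ≼ parent t) end (below ≤-refl)
    where
    open Walk W
    below : ∀ {k} → k ≤ length → w ≼ parent (vertex k)
    below {zero}  _   = subst (λ t → w ≼ parent t) (sym start) w≼px
    below {suc k} k<L = ≼parent-step (below (<⇒≤ k<L)) (step k<L) (P⇒≁w (all k<L))

  ≼parent-through : ∀ {w x y} {P : Fin n → Set} → (∀ {t} → P t → ¬ t ~ w) →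
    w ≼ parent x → (Q : PathVia _~_ P x y) → w ≼ parent (PathVia.exit Q)
  ≼parent-through {P = P} P⇒≁w w≼px Q = ≼parent-along P⇒≁w w≼entry walk inner
    where
    open PathVia Q
    w≼entry = ≼parent-step w≼px enter (P⇒≁w (subst P (Walk.start walk) (inner z≤n)))

  -- Walking d ⋯ b from below a, b must point to the last inner vertex v as well as to c, so v and c
  -- are comparable. If v were above c, walking c ⋯ e would put e below a although e → a; so c is
  -- above v, and walking back from v towards d the edge into d must be an arc d → c.
  arc-forced-by-paths : ∀ {a b c d e} {P₁ P₂ : Fin n → Set} →
    Arc T b a → Arc T b c → Arc T e a → a ≼ parent d → c ~ d →
    (∀ {q} → P₁ q → ¬ q ~ a × ¬ q ~ c × q ≢ c × ¬ q ~ e) →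
    (∀ {q r} → P₁ q → P₂ r → ¬ r ~ q) →
    PathVia _~_ P₁ d b → PathVia _~_ P₂ c e → Arc T d c
  arc-forced-by-paths {a} {b} {c} {d} {e} {P₁} ba bc ea a≼pd c~d P₁-avoids P₁≁P₂ Q R =
    forced (P₁-avoids exit-inner) (out-neighbours-comparable bc b-exit)
    where
    open PathVia Q
    a≼p-exit : a ≼ parent exit
    a≼p-exit = ≼parent-through (proj₁ ∘ P₁-avoids) a≼pd Q
    b-exit : Arc T b exit
    b-exit = proj₁ (edge-leaving-subtree a≼p-exit (arc⇒⋡ ba) leave)
    forced : ¬ exit ~ a × ¬ exit ~ c × exit ≢ c × ¬ exit ~ e → c ≼ exit ⊎ exit ≼ c → Arc T d c
    forced (_ , _ , exit≢c , _) (inj₁ c≼exit) =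
      proj₂ (edge-leaving-subtree c≼p-entry (~⇒⋠ c~d) (~-sym enter))
      where
      c≼p-entry : c ≼ parent entry
      c≼p-entry = ≼parent-along (proj₁ ∘ proj₂ ∘ P₁-avoids) (≼∧≢⇒≼parent c≼exit exit≢c)
        (reverse ~-sym walk) (all-reverse {P = P₁} ~-sym walk inner)
    forced (_ , _ , exit≢c , exit≁e) (inj₂ exit≼c) =
      ⊥-elim (arc⇒⋡ ea (≼-trans a≼p-exit (≼-trans parent-≼ (≼-trans exit≼pe parent-≼))))
      where
      exit≼pe : exit ≼ parent e
      exit≼pe = ≼parent-step (≼parent-through (P₁≁P₂ exit-inner) (≼∧≢⇒≼parent exit≼c (≢-sym exit≢c)) R)
        (PathVia.leave R) (exit≁e ∘ ~-sym)

  source-over-paths-impossible : ∀ {a b c d e} {P₁ P₂ : Fin n → Set} →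
    c ~ d → d ~ e → e ~ a → ¬ d ~ a → Arc T b a → Arc T b c → a ≼ parent c →
    (∀ {q} → P₁ q → ¬ q ~ a × ¬ q ~ c × q ≢ c × ¬ q ~ e) →
    (∀ {r} → P₂ r → ¬ r ~ a × ¬ r ~ d × r ≢ d × ¬ r ~ b) →
    (∀ {q r} → P₁ q → P₂ r → ¬ q ~ r) →
    PathVia _~_ P₁ d b → PathVia _~_ P₂ c e → ⊥
  source-over-paths-impossible c~d d~e e~a d≁a ba bc a≼pc P₁-avoids P₂-avoids P₁≁P₂ Q R =
    no-2-cycle dc cd
    where
    a≼pd = ≼parent-step a≼pc c~d d≁a
    e-arcs = edge-leaving-subtree a≼pd (~⇒⋠ (~-sym e~a)) d~e
    dc = arc-forced-by-paths ba bc (proj₂ e-arcs) a≼pd c~d P₁-avoids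
           (λ q r r~q → P₁≁P₂ q r (~-sym r~q)) Q R
    cd = arc-forced-by-paths (proj₂ e-arcs) (proj₁ e-arcs) ba a≼pc (~-sym c~d) P₂-avoids
           (λ r q → P₁≁P₂ q r) R Q

Side : Fin 5 → Fin 5 → Set
Side x y = CycleEdge x y ⊎ CycleEdge y x

Diagonal : Fin 5 → Fin 5 → Set
Diagonal x y = x ≢ y × ¬ Side x y

Pentagon : Fin 5 → Fin 5 → Fin 5 → Fin 5 → Fin 5 → Set
Pentagon a b c d e =
  Side a b × Side b c × Side c d × Side d e × Side e a ×
  Diagonal a c × Diagonal a d × Diagonal b d × Diagonal b e × Diagonal c e

cycleEdge? : Decidable CycleEdge
cycleEdge? x y = (toℕ y ≟ℕ suc (toℕ x)) ⊎-dec ((toℕ x ≟ℕ 0) ×-dec (toℕ y ≟ℕ 4))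

side? : Decidable Side
side? x y = cycleEdge? x y ⊎-dec cycleEdge? y x

diagonal? : Decidable Diagonal
diagonal? x y = ¬? (x ≟ y) ×-dec ¬? (side? x y)

pentagon? : ∀ a b c d e → Dec (Pentagon a b c d e)
pentagon? a b c d e =
  side? a b ×-dec side? b c ×-dec side? c d ×-dec side? d e ×-dec side? e a ×-dec
  diagonal? a c ×-dec diagonal? a d ×-dec diagonal? b d ×-dec diagonal? b e ×-dec diagonal? c e

pentagon : ∀ a b c d e → {True (pentagon? a b c d e)} → Pentagon a b c d e
pentagon a b c d e {decided} = toWitness decided

side-sym : ∀ {x y} → Side x y → Side y x
side-sym (inj₁ xy) = inj₂ xy
side-sym (inj₂ yx) = inj₁ yx

diagonal-sym : ∀ {x y} → Diagonal x y → Diagonal y x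
diagonal-sym (x≢y , ¬side) = ≢-sym x≢y , ¬side ∘ side-sym

pentagon-reflect : ∀ {a b c d e} → Pentagon a b c d e → Pentagon c b a e d
pentagon-reflect (ab , bc , cd , de , ea , ac , ad , bd , be , ce) =
  side-sym bc , side-sym ab , side-sym ea , side-sym de , side-sym cd ,
  diagonal-sym ac , ce , be , bd , ad

cycleEdge⇒< : ∀ {x y} → CycleEdge x y → x <ᶠ y
cycleEdge⇒< {x} {y} (inj₁ y≡1+x) = subst (toℕ x <_) (sym y≡1+x) ≤-refl
cycleEdge⇒< {x} {y} (inj₂ (x≡0 , y≡4)) = subst₂ _<_ (sym x≡0) (sym y≡4) (s≤s z≤n)

side⇒≢ : ∀ {x y} → Side x y → x ≢ y
side⇒≢ side refl with side
... | inj₁ xx = <-irrefl refl (cycleEdge⇒< xx)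
... | inj₂ xx = <-irrefl refl (cycleEdge⇒< xx)

SameEnds : Fin 5 → Fin 5 → Fin 5 → Fin 5 → Set
SameEnds i j x y = (i ≡ x × j ≡ y) ⊎ (i ≡ y × j ≡ x)

ends∈ : ∀ {i j x y} → SameEnds i j x y → (i ≡ x ⊎ i ≡ y) × (j ≡ x ⊎ j ≡ y)
ends∈ (inj₁ (i≡x , j≡y)) = inj₁ i≡x , inj₂ j≡y
ends∈ (inj₂ (i≡y , j≡x)) = inj₂ i≡y , inj₁ j≡x

shared-end : ∀ {i x y x′ y′ : Fin 5} → i ≡ x ⊎ i ≡ y → i ≡ x′ ⊎ i ≡ y′ →
  x ≢ x′ → x ≢ y′ → y ≢ x′ → y ≢ y′ → ⊥
shared-end (inj₁ refl) i∈′ x≢x′ x≢y′ _ _ = [ x≢x′ , x≢y′ ]′ i∈′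
shared-end (inj₂ refl) i∈′ _ _ y≢x′ y≢y′ = [ y≢x′ , y≢y′ ]′ i∈′

module Subdivision (sub : Subdiv) where

  infix 4 _~ₛ_
  _~ₛ_ : SubV sub → SubV sub → Set
  _~ₛ_ = SubAdj sub

  ~ₛ-sym : Symmetric _~ₛ_
  ~ₛ-sym (inj₁ step) = inj₂ step
  ~ₛ-sym (inj₂ step) = inj₁ step

  data Interior (x y : Fin 5) : SubV sub → Set where
    interior : ∀ {i j p} (t : Fin (sub i j p)) → SameEnds i j x y → Interior x y (int i j p t)

  interior-sym : ∀ {x y u} → Interior x y u → Interior y x u
  interior-sym (interior t (inj₁ ends)) = interior t (inj₂ ends)
  interior-sym (interior t (inj₂ ends)) = interior t (inj₁ ends)

  interior≢branch : ∀ {x y u k} → Interior x y u → u ≢ br k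
  interior≢branch (interior _ _) ()

  interior-branch-nonadjacent : ∀ {x y u k} → Interior x y u → k ≢ x → k ≢ y → ¬ u ~ₛ br k
  interior-branch-nonadjacent (interior _ ends) k≢x k≢y (inj₁ (final _ _ _ _ _)) =
    [ k≢x , k≢y ]′ (proj₂ (ends∈ ends))
  interior-branch-nonadjacent (interior _ ends) k≢x k≢y (inj₂ (first _ _ _ _ _)) =
    [ k≢x , k≢y ]′ (proj₁ (ends∈ ends))

  interiors-nonadjacent : ∀ {x y x′ y′ u u′} → Interior x y u → Interior x′ y′ u′ →
    x ≢ x′ → x ≢ y′ → y ≢ x′ → y ≢ y′ → ¬ u ~ₛ u′
  interiors-nonadjacent (interior _ ends) (interior _ ends′) x≢x′ x≢y′ y≢x′ y≢y′ (inj₁ (middle _ _ _ _ _ _)) =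
    shared-end (proj₁ (ends∈ ends)) (proj₁ (ends∈ ends′)) x≢x′ x≢y′ y≢x′ y≢y′
  interiors-nonadjacent (interior _ ends) (interior _ ends′) x≢x′ x≢y′ y≢x′ y≢y′ (inj₂ (middle _ _ _ _ _ _)) =
    shared-end (proj₁ (ends∈ ends)) (proj₁ (ends∈ ends′)) x≢x′ x≢y′ y≢x′ y≢y′

  -- The walk int 0, …, int (s - 1) along the subdivided edge, s = sub i j p ≥ 1; beyond it `along` is junk.
  module EdgePath (i j : Fin 5) (p : i <ᶠ j) (subdivided : 1 ≤ sub i j p) where

    along : ℕ → SubV sub
    along k with k <? sub i j p
    ... | yes k<s = int i j p (fromℕ< k<s)
    ... | no  _   = br j

    pred-s<s : ∀ {k} → k ≤ pred (sub i j p) → k < sub i j p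
    pred-s<s {k} k≤ = subst (k <_) (suc-pred (sub i j p) {{>-nonZero subdivided}}) (s≤s k≤)

    enter : br i ~ₛ along 0
    enter with 0 <? sub i j p
    ... | yes 0<s = inj₁ (first i j p (fromℕ< 0<s) (toℕ-fromℕ< 0<s))
    ... | no  0≮s = contradiction subdivided 0≮s

    step : ∀ {k} → k < pred (sub i j p) → along k ~ₛ along (suc k)
    step {k} k<s-1 with k <? sub i j p | suc k <? sub i j p
    ... | yes k<s | yes 1+k<s =
      inj₁ (middle i j p (fromℕ< k<s) (fromℕ< 1+k<s) (trans (toℕ-fromℕ< 1+k<s) (cong suc (sym (toℕ-fromℕ< k<s)))))
    ... | _       | no 1+k≮s = contradiction (pred-s<s k<s-1) 1+k≮s
    ... | no k≮s  | _        = contradiction (pred-s<s (<⇒≤ k<s-1)) k≮s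

    leave : along (pred (sub i j p)) ~ₛ br j
    leave with pred (sub i j p) <? sub i j p
    ... | yes h = inj₁ (final i j p (fromℕ< h)
                    (trans (cong suc (toℕ-fromℕ< h)) (suc-pred (sub i j p) {{>-nonZero subdivided}})))
    ... | no  h = contradiction (pred-s<s ≤-refl) h

    inner : ∀ {k} → k ≤ pred (sub i j p) → Interior i j (along k)
    inner {k} k≤ with k <? sub i j p
    ... | yes _   = interior _ (inj₁ (refl , refl))
    ... | no  k≮s = contradiction (pred-s<s k≤) k≮s

    path : PathVia _~ₛ_ (Interior i j) (br i) (br j)
    path = record
      { enter = enter
      ; walk  = record { length = pred (sub i j p) ; vertex = along ; start = refl ; end = refl ; step = step }
      ; leave = leave
      ; inner = inner
      }

  module _ (typeB : TypeB sub) where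

    side⇒adjacent : ∀ {x y} → Side x y → br x ~ₛ br y
    side⇒adjacent {x} {y} (inj₁ xy) = inj₁ (direct x y (cycleEdge⇒< xy) (proj₁ (typeB x y _) xy))
    side⇒adjacent {x} {y} (inj₂ yx) = inj₂ (direct y x (cycleEdge⇒< yx) (proj₁ (typeB y x _) yx))

    diagonal⇒nonadjacent : ∀ {x y} → Diagonal x y → ¬ br x ~ₛ br y
    diagonal⇒nonadjacent {x} {y} (_ , ¬side) (inj₁ (direct _ _ p unsubdivided)) =
      contradiction (subst (1 ≤_) unsubdivided (proj₂ (typeB x y p) (¬side ∘ inj₁))) λ ()
    diagonal⇒nonadjacent {x} {y} (_ , ¬side) (inj₂ (direct _ _ p unsubdivided)) =
      contradiction (subst (1 ≤_) unsubdivided (proj₂ (typeB y x p) (¬side ∘ inj₂))) λ ()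

    diagonalPath : ∀ {x y} → Diagonal x y → PathVia _~ₛ_ (Interior x y) (br x) (br y)
    diagonalPath {x} {y} (x≢y , ¬side) with <-cmp x y
    ... | tri< x<y _ _ = EdgePath.path x y x<y (proj₂ (typeB x y x<y) (¬side ∘ inj₁))
    ... | tri≈ _ x≡y _ = contradiction x≡y x≢y
    ... | tri> _ _ y<x =
      reversePath ~ₛ-sym (mapPath id id interior-sym (EdgePath.path y x y<x (proj₂ (typeB y x y<x) (¬side ∘ inj₂))))

module Embedding (sub : Subdiv) (typeB : TypeB sub) {n : ℕ} (T : BurlingTree n)
  (g : SubV sub → Fin n) (g-injective : Injective _≡_ _≡_ g)
  (g-hom : ∀ {u v} → SubAdj sub u v → BurlingTreeProperties._~_ T (g u) (g v))
  (g-reflects : ∀ {u v} → BurlingTreeProperties._~_ T (g u) (g v) → SubAdj sub u v) where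

  open Subdivision sub
  open BurlingTreeProperties T
  open BurlingTree T using (parent)

  branch : Fin 5 → Fin n
  branch k = g (br k)

  branch-injective : ∀ {i j} → branch i ≡ branch j → i ≡ j
  branch-injective gi≡gj with g-injective gi≡gj
  ... | refl = refl

  branch-adjacent : ∀ {x y} → Side x y → branch x ~ branch y
  branch-adjacent = g-hom ∘ side⇒adjacent typeB

  branch-nonadjacent : ∀ {x y} → Diagonal x y → ¬ branch x ~ branch y
  branch-nonadjacent diagonal = diagonal⇒nonadjacent typeB diagonal ∘ g-reflects

  OnDiagonal : Fin 5 → Fin 5 → Fin n → Set
  OnDiagonal x y t = ∃[ u ] (Interior x y u × g u ≡ t)

  diagonal-path : ∀ {x y} → Diagonal x y → PathVia _~_ (OnDiagonal x y) (branch x) (branch y)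
  diagonal-path diagonal = mapPath g g-hom (λ {u} inside → u , inside , refl) (diagonalPath typeB diagonal)

  onDiagonal-branch-nonadjacent : ∀ {x y t k} → OnDiagonal x y t → k ≢ x → k ≢ y → ¬ t ~ branch k
  onDiagonal-branch-nonadjacent (_ , inside , refl) k≢x k≢y =
    interior-branch-nonadjacent inside k≢x k≢y ∘ g-reflects

  onDiagonal≢branch : ∀ {x y t k} → OnDiagonal x y t → t ≢ branch k
  onDiagonal≢branch (_ , inside , refl) = interior≢branch inside ∘ g-injective

  onDiagonals-nonadjacent : ∀ {x y x′ y′ t t′} → OnDiagonal x y t → OnDiagonal x′ y′ t′ →
    x ≢ x′ → x ≢ y′ → y ≢ x′ → y ≢ y′ → ¬ t ~ t′
  onDiagonals-nonadjacent (_ , inside , refl) (_ , inside′ , refl) x≢x′ x≢y′ y≢x′ y≢y′ =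
    interiors-nonadjacent inside inside′ x≢x′ x≢y′ y≢x′ y≢y′ ∘ g-reflects

  source-above-impossible : ∀ {a b c d e} → Pentagon a b c d e →
    Arc T (branch b) (branch a) → Arc T (branch b) (branch c) → branch a ≼ parent (branch c) → ⊥
  source-above-impossible (ab , bc , cd , de , ea , (a≢c , _) , ad , bd , (b≢e , _) , ce) ba bc′ a≼pc =
    source-over-paths-impossible (branch-adjacent cd) (branch-adjacent de) (branch-adjacent ea)
      (branch-nonadjacent (diagonal-sym ad)) ba bc′ a≼pc
      (λ q → avoids q a≢d a≢b , avoids q c≢d c≢b , onDiagonal≢branch q , avoids q e≢d e≢b)
      (λ r → avoids r a≢c a≢e , avoids r d≢c d≢e , onDiagonal≢branch r , avoids r b≢c b≢e)
      (λ q r → onDiagonals-nonadjacent q r d≢c d≢e b≢c b≢e)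
      (diagonal-path (diagonal-sym bd)) (diagonal-path ce)
    where
    avoids = onDiagonal-branch-nonadjacent
    a≢b = side⇒≢ ab
    a≢d = proj₁ ad
    a≢e = ≢-sym (side⇒≢ ea)
    b≢c = side⇒≢ bc
    c≢b = ≢-sym b≢c
    c≢d = side⇒≢ cd
    d≢c = ≢-sym c≢d
    d≢e = side⇒≢ de
    e≢d = ≢-sym d≢e
    e≢b = ≢-sym b≢e

  source-impossible : ∀ {a b c d e} → Pentagon a b c d e →
    Arc T (branch b) (branch a) → Arc T (branch b) (branch c) → ⊥
  source-impossible pent@(_ , _ , _ , _ , _ , (a≢c , _) , _) ba bc with out-neighbours-comparable ba bc
  ... | inj₁ a≼c = source-above-impossible pent ba bc (≼∧≢⇒≼parent a≼c (a≢c ∘ sym ∘ branch-injective))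
  ... | inj₂ c≼a = source-above-impossible (pentagon-reflect pent) bc ba (≼∧≢⇒≼parent c≼a (a≢c ∘ branch-injective))

  -- Orient the pentagon 0 1 2 3 4: either it is a directed cycle or some branch vertex
  -- points to both of its neighbours.
  no-embedding : ⊥
  no-embedding =
    let s₀₁ , s₁₂ , s₂₃ , s₃₄ , s₄₀ , _ = pentagon (# 0) (# 1) (# 2) (# 3) (# 4)
    in  orient (branch-adjacent s₀₁) (branch-adjacent s₁₂) (branch-adjacent s₂₃)
               (branch-adjacent s₃₄) (branch-adjacent s₄₀)
    where
    orient : branch (# 0) ~ branch (# 1) → branch (# 1) ~ branch (# 2) → branch (# 2) ~ branch (# 3) →
             branch (# 3) ~ branch (# 4) → branch (# 4) ~ branch (# 0) → ⊥
    orient (inj₁ a₀₁) _ _ _ (inj₂ a₀₄) = source-impossible (pentagon (# 4) (# 0) (# 1) (# 2) (# 3)) a₀₄ a₀₁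
    orient (inj₂ a₁₀) (inj₁ a₁₂) _ _ _ = source-impossible (pentagon (# 0) (# 1) (# 2) (# 3) (# 4)) a₁₀ a₁₂
    orient _ (inj₂ a₂₁) (inj₁ a₂₃) _ _ = source-impossible (pentagon (# 1) (# 2) (# 3) (# 4) (# 0)) a₂₁ a₂₃
    orient _ _ (inj₂ a₃₂) (inj₁ a₃₄) _ = source-impossible (pentagon (# 2) (# 3) (# 4) (# 0) (# 1)) a₃₂ a₃₄
    orient _ _ _ (inj₂ a₄₃) (inj₁ a₄₀) = source-impossible (pentagon (# 3) (# 4) (# 0) (# 1) (# 2)) a₄₃ a₄₀
    orient (inj₁ a₀₁) (inj₁ a₁₂) (inj₁ a₂₃) (inj₁ a₃₄) (inj₁ a₄₀) = no-5-cycle a₀₁ a₁₂ a₂₃ a₃₄ a₄₀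
    orient (inj₂ a₁₀) (inj₂ a₂₁) (inj₂ a₃₂) (inj₂ a₄₃) (inj₂ a₀₄) = no-5-cycle a₁₀ a₀₄ a₄₃ a₃₂ a₂₁

mainTheorem11 : (m : ℕ) (Adj : Fin m → Fin m → Set) →
    IsK5SubdivTypeB m Adj → ¬ Derived m Adj
mainTheorem11 m Adj (sub , typeB , φ , ψ , _ , φψ , adj⇔) (n , T , f , f-injective , arc⇔) =
  Embedding.no-embedding sub typeB T (f ∘ ψ) g-injective g-hom g-reflects
  where
  g-injective : Injective _≡_ _≡_ (f ∘ ψ)
  g-injective {u} {v} fψu≡fψv = trans (sym (φψ u)) (trans (cong φ (f-injective fψu≡fψv)) (φψ v))
  g-hom : ∀ {u v} → SubAdj sub u v → BurlingTreeProperties._~_ T (f (ψ u)) (f (ψ v))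
  g-hom {u} {v} u~v =
    proj₁ (arc⇔ (ψ u) (ψ v)) (proj₂ (adj⇔ (ψ u) (ψ v)) (subst₂ (SubAdj sub) (sym (φψ u)) (sym (φψ v)) u~v))
  g-reflects : ∀ {u v} → BurlingTreeProperties._~_ T (f (ψ u)) (f (ψ v)) → SubAdj sub u v
  g-reflects {u} {v} fψu~fψv =
    subst₂ (SubAdj sub) (φψ u) (φψ v) (proj₁ (adj⇔ (ψ u) (ψ v)) (proj₂ (arc⇔ (ψ u) (ψ v)) fψu~fψv))
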